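{- Let $G$ be an abelian group with a direct sum decomposition $G=\mathbb Z\oplus H$, where $\mathbb Z$ denotes an infinite cyclic subgroup and $H<G$ is finite. Let $A\subseteq G$ be finite; for $z\in\mathbb Z$ let $A_z:=A\cap(z+H)$, and let $B:=\{z\in\mathbb Z\colon A_z\ne\emptyset\}$. Assume $\min B=0$, $\max B=l>0$, $0\in A_0$, and $\delta\in A_l$. Let $n:=|B|$, $\sigma:=|A_0|+|A_l|$, and $A^*:=A_0\cap(A_l-\delta)$. Then $|2A|+|A^*|\ge\sigma n$.
   Context: $2A=\{a+a'\colon a,a'\in A\}$, $A_l-\delta=\{a-\delta\colon a\in A_l\}$. -}

module Defs where

open import Data.Nat using (ℕ)
open import Data.Integer as ℤ using (ℤ)
open import Data.Fin as Fin using (Fin)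
open import Data.Product using (_×_; _,_; proj₁; proj₂)
open import Data.Product.Properties using (≡-dec)
open import Data.List using (List; length; map; concatMap; filter; deduplicate)
open import Data.List.Membership.DecPropositional using ()
open import Relation.Binary.Definitions using (DecidableEquality)
open import Relation.Binary.PropositionalEquality using (_≡_)

-- The ambient group G = ℤ ⊕ H, with H a finite abelian group whose carrier
-- is (w.l.o.g., up to isomorphism) Fin m; the group law of H is passed explicitly.
G : ℕ → Set
G m = ℤ × Fin m

_≟G_ : ∀ {m} → DecidableEquality (G m)
_≟G_ = ≡-dec ℤ._≟_ Fin._≟_

addG : ∀ {m} → (Fin m → Fin m → Fin m) → G m → G m → G m
addG _∙_ (z , h) (z' , h') = (z ℤ.+ z' , h ∙ h')

card : {X : Set} → DecidableEquality X → List X → ℕ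
card eq xs = length (deduplicate eq xs)

twice : ∀ {m} → (Fin m → Fin m → Fin m) → List (G m) → List (G m)
twice _∙_ A = concatMap (λ a → map (addG _∙_ a) A) A

fiber : ∀ {m} → ℤ → List (G m) → List (G m)
fiber z A = filter (λ x → proj₁ x ℤ.≟ z) A

support : ∀ {m} → List (G m) → List ℤ
support A = map proj₁ A

-- A* = A_0 ∩ (A_l - δ) = { a ∈ A_0 : a + δ ∈ A_l }
--   (note: a ∈ A_0 and δ ∈ A_l give a + δ ∈ l + H automatically, so
--    a + δ ∈ A_l iff a + δ ∈ A)
Astar : ∀ {m} → (Fin m → Fin m → Fin m) → List (G m) → G m → List (G m)
Astar {m} _∙_ A δ = filter (λ a → addG _∙_ a δ ∈? A) (fiber (ℤ.+ 0) A)
  where open Data.List.Membership.DecPropositional (_≟G_ {m}) using (_∈?_)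

{-# OPTIONS --safe #-}
module Submission where

open import Defs
open import Data.Nat using (ℕ; _+_; _*_; _≥_)
open import Data.Integer as ℤ using (ℤ)
open import Data.Fin using (Fin)
open import Data.Product using (_×_; _,_; proj₁)
open import Data.List using (List)
open import Data.List.Membership.Propositional using (_∈_)
open import Algebra.Structures using (IsAbelianGroup)
open import Relation.Binary.PropositionalEquality using (_≡_)

open import Algebra.Structures using (IsGroup)
open import Algebra.Bundles using (Group; AbelianGroup)
open import Algebra.Definitions using (RightCancellative)
import Algebra.Properties.Group as GroupProperties
open import Data.Empty using (⊥-elim)
open import Data.Nat using (suc; _≤_; z≤n; s≤s)
open import Data.Nat.Properties using (≤-trans; +-suc; +-mono-≤; +-cancelʳ-≡; module ≤-Reasoning)
open import Data.Nat.Solver using (module +-*-Solver)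
import Data.Integer.Properties as ℤ
open import Data.Maybe using (fromMaybe)
open import Data.Product using (∃-syntax; proj₂)
open import Data.Sum using (inj₁; inj₂)
open import Data.List using ([]; _∷_; _++_; map; concatMap; filter; deduplicate; length; head)
open import Data.List.Properties using (filter-notAll; length-map; length-++)
open import Data.List.Membership.Propositional using (find)
open import Data.List.Membership.Propositional.Properties
  using (∈-filter⁺; ∈-filter⁻; ∈-deduplicate⁺; ∈-deduplicate⁻; ∈-map⁺; ∈-map⁻; ∈-concatMap⁺; ∈-concatMap⁻; ∈-++⁻)
import Data.List.Membership.DecPropositional as DecMembership
open import Data.List.Relation.Unary.Any as Any using (here; there)
open import Data.List.Relation.Unary.All as All using (_∷_)
open import Data.List.Relation.Unary.Unique.Propositional using (Unique; []; _∷_)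
import Data.List.Relation.Unary.Unique.Propositional.Properties as Unique
import Data.List.Relation.Unary.Unique.DecPropositional.Properties as UniqueDec
open import Data.List.Relation.Binary.Disjoint.Propositional using (Disjoint)
open import Data.List.Relation.Binary.Subset.Propositional using (_⊆_)
open import Data.List.Relation.Binary.Subset.Propositional.Properties using (filter-⊆; filter⁺′)
open import Function using (_∘_)
open import Relation.Binary.Definitions using (DecidableEquality)
open import Relation.Binary.PropositionalEquality using (refl; sym; trans; cong; cong₂; subst; subst₂; _≢_; module ≡-Reasoning)
open import Relation.Nullary using (¬_; yes; no)
open import Relation.Unary using (Pred; Decidable)
open import Relation.Unary.Properties using (∁?)

-- Write level x for the ℤ-coordinate of x and pick a representative a_z ∈ A_z of every level z ∈ B.
-- Then 2A contains the following sets, on pairwise distinct levels: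
--   A₀ + a_z for z ∈ B ∖ {l}   (levels below l),
--   A_l + a_z for z ∈ B ∖ {0}   (levels above l),
--   A_l = 0 + A_l and (A₀ ∖ A*) + δ   (level l; disjoint, since (A₀ ∖ A*) + δ avoids A by the definition of A*).
-- Translation is injective, so
--   |2A| ≥ (n − 1)|A₀| + (n − 1)|A_l| + |A_l| + |A₀| − |A*| = σn − |A*|.

module _ {X : Set} where

  ⊆-Unique⇒length≤ : DecidableEquality X → {xs ys : List X} → Unique ys → ys ⊆ xs → length ys ≤ length xs
  ⊆-Unique⇒length≤ _≟_ {ys = []} _ _ = z≤n
  ⊆-Unique⇒length≤ _≟_ {xs} {y ∷ ys} (y∉ys ∷ ys!) y∷ys⊆xs =
    ≤-trans (s≤s (⊆-Unique⇒length≤ _≟_ ys! ys⊆xs-y))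
            (filter-notAll (∁? (y ≟_)) xs (Any.map (λ y≡x y≢x → y≢x y≡x) (y∷ys⊆xs (here refl))))
    where
    ys⊆xs-y : ys ⊆ filter (∁? (y ≟_)) xs
    ys⊆xs-y z∈ys = ∈-filter⁺ (∁? (y ≟_)) (y∷ys⊆xs (there z∈ys)) (All.lookup y∉ys z∈ys)

  ⊆-Unique⇒length≤card : (_≟_ : DecidableEquality X) {xs ys : List X} → Unique ys → ys ⊆ xs → length ys ≤ card _≟_ xs
  ⊆-Unique⇒length≤card _≟_ ys! ys⊆xs = ⊆-Unique⇒length≤ _≟_ ys! (∈-deduplicate⁺ _≟_ ∘ ys⊆xs)

  length-filter+∁ : ∀ {ℓ} {P : Pred X ℓ} (P? : Decidable P) (xs : List X) →
                    length (filter P? xs) + length (filter (∁? P?) xs) ≡ length xs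
  length-filter+∁ P? [] = refl
  length-filter+∁ P? (x ∷ xs) with P? x
  ... | yes _ = cong suc (length-filter+∁ P? xs)
  ... | no _  = trans (+-suc _ _) (cong suc (length-filter+∁ P? xs))

  Unique-constant⇒length≡1 : {c : X} {xs : List X} → Unique xs → c ∈ xs → (∀ {x} → x ∈ xs → x ≡ c) → length xs ≡ 1
  Unique-constant⇒length≡1 {xs = _ ∷ []} _ _ _ = refl
  Unique-constant⇒length≡1 {xs = _ ∷ _ ∷ _} ((x≢y ∷ _) ∷ _) _ ≡c = ⊥-elim (x≢y (trans (≡c (here refl)) (sym (≡c (there (here refl))))))

  length-filter-all-but-one : ∀ {ℓ} {P : Pred X ℓ} (P? : Decidable P) {c : X} {xs : List X} → Unique xs → c ∈ xs → ¬ P c →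
                              (∀ {x} → x ∈ xs → ¬ P x → x ≡ c) → length (filter P? xs) + 1 ≡ length xs
  length-filter-all-but-one P? {c} {xs} xs! c∈xs ¬Pc only-c =
    trans (cong (length (filter P? xs) +_) (sym |∁P|≡1)) (length-filter+∁ P? xs)
    where
    |∁P|≡1 : length (filter (∁? P?) xs) ≡ 1
    |∁P|≡1 = Unique-constant⇒length≡1 (Unique.filter⁺ (∁? P?) xs!) (∈-filter⁺ (∁? P?) c∈xs ¬Pc)
               (λ x∈ → let (x∈xs , ¬Px) = ∈-filter⁻ (∁? P?) x∈ in only-c x∈xs ¬Px)

  fromMaybe-head-∈ : {d x : X} {xs : List X} → x ∈ xs → fromMaybe d (head xs) ∈ xs
  fromMaybe-head-∈ {xs = _ ∷ _} _ = here refl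

  fromMaybe-head-satisfies : ∀ {ℓ} {P : Pred X ℓ} {d : X} (xs : List X) → P d → (∀ {x} → x ∈ xs → P x) → P (fromMaybe d (head xs))
  fromMaybe-head-satisfies []      Pd _   = Pd
  fromMaybe-head-satisfies (_ ∷ _) _  Pxs = Pxs (here refl)

  ++-⊆ : {xs ys zs : List X} → xs ⊆ zs → ys ⊆ zs → xs ++ ys ⊆ zs
  ++-⊆ {xs} xs⊆zs ys⊆zs x∈ with ∈-++⁻ xs x∈
  ... | inj₁ x∈xs = xs⊆zs x∈xs
  ... | inj₂ x∈ys = ys⊆zs x∈ys

module _ {X Y : Set} where

  Unique-concatMap⁺ : {f : X → List Y} → (∀ x → Unique (f x)) → (∀ {x x'} → x ≢ x' → Disjoint (f x) (f x')) →
                      {xs : List X} → Unique xs → Unique (concatMap f xs)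
  Unique-concatMap⁺ f! disjoint [] = []
  Unique-concatMap⁺ {f} f! disjoint {x ∷ xs} (x∉xs ∷ xs!) =
    Unique.++⁺ (f! x) (Unique-concatMap⁺ f! disjoint xs!) λ (y∈fx , y∈rest) →
      let (x' , x'∈xs , y∈fx') = find (∈-concatMap⁻ f {xs = xs} y∈rest)
      in disjoint (All.lookup x∉xs x'∈xs) (y∈fx , y∈fx')

  length-concatMap-const : {f : X → List Y} {c : ℕ} → (∀ x → length (f x) ≡ c) → (xs : List X) → length (concatMap f xs) ≡ length xs * c
  length-concatMap-const |f|≡c [] = refl
  length-concatMap-const {f} |f|≡c (x ∷ xs) = trans (length-++ (f x)) (cong₂ _+_ (|f|≡c x) (length-concatMap-const |f|≡c xs))

private
  module ℤ+ = GroupProperties (AbelianGroup.group ℤ.+-0-abelianGroup)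

module Translates {m} {_∙_ : Fin m → Fin m → Fin m} {ε : Fin m} {_⁻¹ : Fin m → Fin m}
                  (isGroup : IsGroup _≡_ _∙_ ε _⁻¹) where

  private
    H : Group _ _
    H = record { isGroup = isGroup }

    module H = GroupProperties H

  infixl 6 _⊕_
  _⊕_ : G m → G m → G m
  _⊕_ = addG _∙_

  level : G m → ℤ
  level = proj₁

  ⊕-cancelʳ : RightCancellative _≡_ _⊕_
  ⊕-cancelʳ (z , h) (x , g) (y , g') eq =
    cong₂ _,_ (ℤ+.∙-cancelʳ z x y (cong proj₁ eq)) (H.∙-cancelʳ h g g' (cong proj₂ eq))

  ⊕-identityˡ : ∀ x → (ℤ.+ 0 , ε) ⊕ x ≡ x
  ⊕-identityˡ (z , h) = cong₂ _,_ (ℤ.+-identityˡ z) (IsGroup.identityˡ isGroup h)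

  translate : G m → List (G m) → List (G m)
  translate r = map (_⊕ r)

  translate-Unique : ∀ r {xs} → Unique xs → Unique (translate r xs)
  translate-Unique r = Unique.map⁺ (⊕-cancelʳ r _ _)

  translate-level : ∀ r {c xs y} → (∀ {x} → x ∈ xs → level x ≡ c) → y ∈ translate r xs → level y ≡ c ℤ.+ level r
  translate-level r lv y∈ with ∈-map⁻ (_⊕ r) y∈
  ... | x , x∈xs , refl = cong (ℤ._+ level r) (lv x∈xs)

  ⊕∈twice : ∀ {A x y} → x ∈ A → y ∈ A → x ⊕ y ∈ twice _∙_ A
  ⊕∈twice {A} {x} x∈A y∈A = ∈-concatMap⁺ (λ a → map (a ⊕_) A) (Any.map (λ { refl → ∈-map⁺ (x ⊕_) y∈A }) x∈A)

  translate⊆twice : ∀ {A r xs} → xs ⊆ A → r ∈ A → translate r xs ⊆ twice _∙_ A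
  translate⊆twice xs⊆A r∈A y∈ with ∈-map⁻ _ y∈
  ... | x , x∈xs , refl = ⊕∈twice (xs⊆A x∈xs) r∈A

-- σn with n = k + 1 and |A₀| = q + r, regrouped as the sizes of the three families plus q = |A*|.
count-rearrangement : ∀ {k k' n a₀ aₗ q r} → k + 1 ≡ n → k' + 1 ≡ n → q + r ≡ a₀ →
                      (a₀ + aₗ) * n ≡ (k * a₀ + (k' * aₗ + (r + aₗ))) + q
count-rearrangement {k} {k'} {aₗ = aₗ} {q} {r} refl k'+1≡k+1 refl rewrite +-cancelʳ-≡ 1 k' k k'+1≡k+1 =
  solve 4 (λ k aₗ q r → (q :+ r :+ aₗ) :* (k :+ con 1) := (k :* (q :+ r) :+ (k :* aₗ :+ (r :+ aₗ))) :+ q) refl k aₗ q r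
  where open +-*-Solver

module LevelDecomposition
  {m} {_∙_ : Fin m → Fin m → Fin m} {ε : Fin m} {_⁻¹ : Fin m → Fin m}
  (isGroup : IsGroup _≡_ _∙_ ε _⁻¹)
  (A : List (G m)) {l : ℤ} {δ : G m}
  (levels-bounded : ∀ a → a ∈ A → (ℤ.+ 0 ℤ.≤ proj₁ a) × (proj₁ a ℤ.≤ l))
  (0∈A : (ℤ.+ 0 , ε) ∈ A) (δ-level : proj₁ δ ≡ l) (δ∈A : δ ∈ A) where

  open Translates isGroup
  open DecMembership (_≟G_ {m}) using (_∈?_)

  Fib : ℤ → List (G m)
  Fib z = deduplicate _≟G_ (fiber z A)

  A₀ Aₗ : List (G m)
  A₀ = Fib (ℤ.+ 0)
  Aₗ = Fib l

  B : List ℤ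
  B = deduplicate ℤ._≟_ (support A)

  Fib-Unique : ∀ z → Unique (Fib z)
  Fib-Unique z = UniqueDec.deduplicate-! _≟G_ (fiber z A)

  B-Unique : Unique B
  B-Unique = UniqueDec.deduplicate-! ℤ._≟_ (support A)

  ∈fiber⁻ : ∀ {z x} → x ∈ fiber z A → x ∈ A × level x ≡ z
  ∈fiber⁻ {z} = ∈-filter⁻ (λ x → level x ℤ.≟ z)

  ∈Fib⁻ : ∀ {z x} → x ∈ Fib z → x ∈ A × level x ≡ z
  ∈Fib⁻ {z} = ∈fiber⁻ ∘ ∈-deduplicate⁻ _≟G_ (fiber z A)

  Fib⊆A : ∀ z → Fib z ⊆ A
  Fib⊆A z = proj₁ ∘ ∈Fib⁻

  ∈B⁺ : ∀ {a} → a ∈ A → level a ∈ B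
  ∈B⁺ = ∈-deduplicate⁺ ℤ._≟_ ∘ ∈-map⁺ level

  ∈B⁻ : ∀ {z} → z ∈ B → ∃[ a ] a ∈ A × z ≡ level a
  ∈B⁻ = ∈-map⁻ level ∘ ∈-deduplicate⁻ ℤ._≟_ (support A)

  -- The default lies on level z, so rep-level needs no assumption z ∈ B.
  rep : ℤ → G m
  rep z = fromMaybe (z , ε) (head (fiber z A))

  rep-level : ∀ z → level (rep z) ≡ z
  rep-level z = fromMaybe-head-satisfies (fiber z A) refl (proj₂ ∘ ∈fiber⁻)

  rep-∈ : ∀ {z} → z ∈ B → rep z ∈ A
  rep-∈ {z} z∈B with ∈B⁻ z∈B
  ... | a , a∈A , refl = proj₁ (∈fiber⁻ (fromMaybe-head-∈ (∈-filter⁺ (λ x → level x ℤ.≟ z) a∈A refl)))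

  sumsWithReps : List (G m) → List ℤ → List (G m)
  sumsWithReps xs = concatMap (λ z → translate (rep z) xs)

  module _ {c : ℤ} {xs : List (G m)} (xs-level : ∀ {x} → x ∈ xs → level x ≡ c) where

    translate-rep-level : ∀ {z y} → y ∈ translate (rep z) xs → level y ≡ c ℤ.+ z
    translate-rep-level {z} y∈ = trans (translate-level (rep z) xs-level y∈) (cong (λ t → c ℤ.+ t) (rep-level z))

    sumsWithReps-level : ∀ {zs y} → y ∈ sumsWithReps xs zs → ∃[ z ] z ∈ zs × level y ≡ c ℤ.+ z
    sumsWithReps-level {zs} y∈ with find (∈-concatMap⁻ (λ z → translate (rep z) xs) {xs = zs} y∈)
    ... | z , z∈zs , y∈xs+rz = z , z∈zs , translate-rep-level y∈xs+rz

    sumsWithReps-Unique : ∀ {zs} → Unique xs → Unique zs → Unique (sumsWithReps xs zs)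
    sumsWithReps-Unique xs! = Unique-concatMap⁺ (λ z → translate-Unique (rep z) xs!) disjoint
      where
      disjoint : ∀ {z z'} → z ≢ z' → Disjoint (translate (rep z) xs) (translate (rep z') xs)
      disjoint {z} {z'} z≢z' (y∈ , y∈') = z≢z' (ℤ+.∙-cancelˡ c z z' (trans (sym (translate-rep-level y∈)) (translate-rep-level y∈')))

  length-sumsWithReps : ∀ xs zs → length (sumsWithReps xs zs) ≡ length zs * length xs
  length-sumsWithReps xs = length-concatMap-const (λ z → length-map (_⊕ rep z) xs)

  sumsWithReps⊆twice : ∀ {xs zs} → xs ⊆ A → zs ⊆ B → sumsWithReps xs zs ⊆ twice _∙_ A
  sumsWithReps⊆twice {xs} {zs} xs⊆A zs⊆B y∈ with find (∈-concatMap⁻ (λ z → translate (rep z) xs) {xs = zs} y∈)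
  ... | z , z∈zs , y∈xs+rz = translate⊆twice xs⊆A (rep-∈ (zs⊆B z∈zs)) y∈xs+rz

  ∈A*? : Decidable (λ a → a ⊕ δ ∈ A)
  ∈A*? a = a ⊕ δ ∈? A

  A*₀ A₀∖A* : List (G m)
  A*₀ = filter ∈A*? A₀
  A₀∖A* = filter (∁? ∈A*?) A₀

  B₋ B₊ : List ℤ
  B₋ = filter (λ z → z ℤ.<? l) B
  B₊ = filter (λ z → ℤ.+ 0 ℤ.<? z) B

  Below Above Middle W : List (G m)
  Below = sumsWithReps A₀ B₋
  Above = sumsWithReps Aₗ B₊
  Middle = translate δ A₀∖A* ++ Aₗ
  W = Below ++ Above ++ Middle

  |B₋|+1≡|B| : length B₋ + 1 ≡ length B
  |B₋|+1≡|B| = length-filter-all-but-one (λ z → z ℤ.<? l) B-Unique l∈B (ℤ.<-irrefl refl) only-l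
    where
    l∈B : l ∈ B
    l∈B = subst (_∈ B) δ-level (∈B⁺ δ∈A)

    only-l : ∀ {z} → z ∈ B → ¬ z ℤ.< l → z ≡ l
    only-l z∈B z≮l with ∈B⁻ z∈B
    ... | a , a∈A , refl = ℤ.≤-antisym (proj₂ (levels-bounded a a∈A)) (ℤ.≮⇒≥ z≮l)

  |B₊|+1≡|B| : length B₊ + 1 ≡ length B
  |B₊|+1≡|B| = length-filter-all-but-one (λ z → ℤ.+ 0 ℤ.<? z) B-Unique (∈B⁺ 0∈A) (ℤ.<-irrefl refl) only-0
    where
    only-0 : ∀ {z} → z ∈ B → ¬ ℤ.+ 0 ℤ.< z → z ≡ ℤ.+ 0
    only-0 z∈B 0≮z with ∈B⁻ z∈B
    ... | a , a∈A , refl = ℤ.≤-antisym (ℤ.≮⇒≥ 0≮z) (proj₁ (levels-bounded a a∈A))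

  Below-level : ∀ {y} → y ∈ Below → level y ℤ.< l
  Below-level y∈ with sumsWithReps-level {xs = A₀} (proj₂ ∘ ∈Fib⁻) {zs = B₋} y∈
  ... | z , z∈B₋ , y-level =
    subst (ℤ._< l) (sym (trans y-level (ℤ.+-identityˡ z))) (proj₂ (∈-filter⁻ (λ z → z ℤ.<? l) {xs = B} z∈B₋))

  Above-level : ∀ {y} → y ∈ Above → l ℤ.< level y
  Above-level y∈ with sumsWithReps-level {xs = Aₗ} (proj₂ ∘ ∈Fib⁻) {zs = B₊} y∈
  ... | z , z∈B₊ , y-level =
    subst₂ ℤ._<_ (ℤ.+-identityʳ l) (sym y-level) (ℤ.+-monoʳ-< l (proj₂ (∈-filter⁻ (λ z → ℤ.+ 0 ℤ.<? z) {xs = B} z∈B₊)))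

  translate-A₀∖A*-∉A : ∀ {y} → y ∈ translate δ A₀∖A* → ¬ y ∈ A
  translate-A₀∖A*-∉A y∈ with ∈-map⁻ (_⊕ δ) {xs = A₀∖A*} y∈
  ... | x , x∈ , refl = proj₂ (∈-filter⁻ (∁? ∈A*?) {xs = A₀} x∈)

  Middle-level : ∀ {y} → y ∈ Middle → level y ≡ l
  Middle-level y∈ with ∈-++⁻ (translate δ A₀∖A*) y∈
  ... | inj₁ y∈A₀∖A*+δ = trans (translate-level δ (proj₂ ∘ ∈Fib⁻ ∘ filter-⊆ (∁? ∈A*?) A₀) y∈A₀∖A*+δ)
                              (trans (ℤ.+-identityˡ (level δ)) δ-level)
  ... | inj₂ y∈Aₗ       = proj₂ (∈Fib⁻ y∈Aₗ)

  W-Unique : Unique W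
  W-Unique =
    Unique.++⁺ (sumsWithReps-Unique (proj₂ ∘ ∈Fib⁻) (Fib-Unique _) (Unique.filter⁺ _ B-Unique))
      (Unique.++⁺ (sumsWithReps-Unique (proj₂ ∘ ∈Fib⁻) (Fib-Unique l) (Unique.filter⁺ _ B-Unique))
        Middle-Unique
        (λ (y∈Above , y∈Middle) → ℤ.<-irrefl (sym (Middle-level y∈Middle)) (Above-level y∈Above)))
      (λ (y∈Below , y∈rest) → ℤ.<⇒≱ (Below-level y∈Below) (rest-level y∈rest))
    where
    Middle-Unique : Unique Middle
    Middle-Unique = Unique.++⁺ (translate-Unique δ (Unique.filter⁺ (∁? ∈A*?) (Fib-Unique _))) (Fib-Unique l)
                      (λ (y∈ , y∈Aₗ) → translate-A₀∖A*-∉A y∈ (Fib⊆A l y∈Aₗ))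

    rest-level : ∀ {y} → y ∈ Above ++ Middle → l ℤ.≤ level y
    rest-level y∈ with ∈-++⁻ Above y∈
    ... | inj₁ y∈Above  = ℤ.<⇒≤ (Above-level y∈Above)
    ... | inj₂ y∈Middle = ℤ.≤-reflexive (sym (Middle-level y∈Middle))

  W⊆twice : W ⊆ twice _∙_ A
  W⊆twice = ++-⊆ (sumsWithReps⊆twice (Fib⊆A _) (filter-⊆ _ B))
              (++-⊆ (sumsWithReps⊆twice (Fib⊆A l) (filter-⊆ _ B))
                (++-⊆ (translate⊆twice (Fib⊆A _ ∘ filter-⊆ (∁? ∈A*?) A₀) δ∈A) Aₗ⊆twice))
    where
    Aₗ⊆twice : Aₗ ⊆ twice _∙_ A
    Aₗ⊆twice {y} y∈Aₗ = subst (_∈ twice _∙_ A) (⊕-identityˡ y) (⊕∈twice 0∈A (Fib⊆A l y∈Aₗ))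

  A*₀-Unique : Unique A*₀
  A*₀-Unique = Unique.filter⁺ ∈A*? (Fib-Unique _)

  A*₀⊆A* : A*₀ ⊆ Astar _∙_ A δ
  A*₀⊆A* = filter⁺′ ∈A*? ∈A*? (λ q → q) (∈-deduplicate⁻ _≟G_ (fiber (ℤ.+ 0) A))

  σn≡|W|+|A*₀| : (length A₀ + length Aₗ) * length B ≡ length W + length A*₀
  σn≡|W|+|A*₀| = begin
    (length A₀ + length Aₗ) * length B
      ≡⟨ count-rearrangement |B₋|+1≡|B| |B₊|+1≡|B| (length-filter+∁ ∈A*? A₀) ⟩
    length B₋ * length A₀ + (length B₊ * length Aₗ + (length A₀∖A* + length Aₗ)) + length A*₀
      ≡⟨ cong (_+ length A*₀) (sym length-W) ⟩
    length W + length A*₀ ∎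
    where
    open ≡-Reasoning

    length-W : length W ≡ length B₋ * length A₀ + (length B₊ * length Aₗ + (length A₀∖A* + length Aₗ))
    length-W = begin
      length W
        ≡⟨ trans (length-++ Below) (cong (length Below +_) (length-++ Above)) ⟩
      length Below + (length Above + length Middle)
        ≡⟨ cong₂ _+_ (length-sumsWithReps A₀ B₋) (cong₂ _+_ (length-sumsWithReps Aₗ B₊) length-Middle) ⟩
      length B₋ * length A₀ + (length B₊ * length Aₗ + (length A₀∖A* + length Aₗ)) ∎
      where
      length-Middle : length Middle ≡ length A₀∖A* + length Aₗ
      length-Middle = trans (length-++ (translate δ A₀∖A*)) (cong (_+ length Aₗ) (length-map (_⊕ δ) A₀∖A*))

lemma6 : (m : ℕ) (_∙_ : Fin m → Fin m → Fin m) (ε : Fin m) (_⁻¹ : Fin m → Fin m)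
    → IsAbelianGroup _≡_ _∙_ ε _⁻¹
    → (A : List (G m)) (l : ℤ) (δ : G m)
    → (∀ a → a ∈ A → (ℤ.+ 0 ℤ.≤ proj₁ a) × (proj₁ a ℤ.≤ l))
    → ℤ.+ 0 ℤ.< l
    → (ℤ.+ 0 , ε) ∈ A
    → proj₁ δ ≡ l
    → δ ∈ A
    → card _≟G_ (twice _∙_ A) + card _≟G_ (Astar _∙_ A δ)
        ≥ (card _≟G_ (fiber (ℤ.+ 0) A) + card _≟G_ (fiber l A)) * card ℤ._≟_ (support A)
lemma6 m _∙_ ε _⁻¹ isAbelianGroup A l δ levels-bounded _ 0∈A δ-level δ∈A = begin
  (length A₀ + length Aₗ) * length B   ≡⟨ σn≡|W|+|A*₀| ⟩
  length W + length A*₀                ≤⟨ +-mono-≤ (⊆-Unique⇒length≤card _≟G_ W-Unique W⊆twice)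
                                                   (⊆-Unique⇒length≤card _≟G_ A*₀-Unique A*₀⊆A*) ⟩
  card _≟G_ (twice _∙_ A) + card _≟G_ (Astar _∙_ A δ) ∎
  where
  open LevelDecomposition (IsAbelianGroup.isGroup isAbelianGroup) A levels-bounded 0∈A δ-level δ∈A
  open ≤-Reasoning
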